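{- Consider any instance of the Online Budgeted Repeated Matching (OBRM) problem (defined in the context) in which every edge weight satisfies $w(i,j)\le C_i$, the instance being fixed in advance independently of the algorithm's random coin flips (oblivious adversary). Let $A(T)$ be the allocation output by the randomized algorithm RANDOMONLINEGREEDY (defined in the context) and $\mathrm{OPT}$ the maximum total weight of a feasible set of edges for the instance. Then $\mathbb{E}[W(A(T))]\ge \tfrac16\,\mathrm{OPT}$, i.e. RANDOMONLINEGREEDY is $6$-competitive.
   Context: OBRM problem: there is a set $I=\{1,\dots,n\}$ of servers, server $i$ having capacity $C_i>0$. At each time step $t\in\{1,\dots,T\}$ a set of jobs $J(t)$ and a set $E(t)$ of edges between servers $I$ and jobs $J(t)$ are revealed, forming the bipartite graph $G(t)=(I\cup J(t),E(t))$; each edge $e=(i,j)$ has a nonnegative weight $w(e)=w(i,j)$ (a job may have different weights on different servers). For a set of edges $F$, $W(F)=\sum_{e\in F}w(e)$. A set of edges $F$ is feasible if (i) for each $t$ the edges of $F$ in $E(t)$ form a matching, and (ii) for each server $i$ the total weight of edges of $F$ incident to $i$ is at most $C_i$. Choices must be made online and irrevocably. A randomized algorithm is $\gamma$-competitive if on every instance its expected total weight is at least $1/\gamma$ times the optimal (offline) feasible weight. Subroutine GREEDY$(G,S)$: given a weighted bipartite graph $G$ and a set $S$ of servers, start with $M=\emptyset$, scan the edges of $G$ in non-increasing order of weight, and add edge $(i,j)$ to $M$ if $i\in S$ and $M\cup\{(i,j)\}$ is still a matching. Return $M$. RANDOMONLINEGREEDY: before the input, for each server $i$ flip an independent fair coin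 $v_i\in\{0,1\}$. Initially $S=I$ and $A_i(0)=B_i(0)=\emptyset$ for all $i$. For $t=1,\dots,T$: set $M(t)=$GREEDY$(G(t),S)$; for each $e=(i,j)\in M(t)$: set $B_i(t)=B_i(t-1)\cup\{e\}$; if $W(B_i(t))>\tfrac12 C_i$ remove $i$ from $S$; if ($v_i=1$ and $w(i,j)>\tfrac12C_i$) or ($v_i=0$ and $w(i,j)\le \tfrac12 C_i$) then set $A_i(t)=A_i(t-1)\cup\{e\}$. (Sets not updated at step $t$ are carried over unchanged.) The output is $A(T)=\bigcup_i A_i(T)$.
   Formalization: The server capacities $C_i$ and the edge weights $w(i,j)$ are rational numbers. -}

module Defs where

open import Data.Bool using (Bool; true; false; if_then_else_; _∧_; _∨_; not)
open import Data.Nat as ℕ using (ℕ; zero; suc; _≡ᵇ_)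
open import Data.Fin as Fin using (Fin; zero; suc)
open import Data.Bool.ListAction using (any)
open import Data.List using (List; []; _∷_; _++_; concat; concatMap; map; filter; foldr)
open import Data.List.Relation.Unary.All using (All)
open import Data.List.Relation.Unary.AllPairs using (AllPairs)
open import Data.List.Relation.Binary.Pointwise using (Pointwise)
open import Data.List.Relation.Binary.Sublist.Propositional using (_⊆_)
open import Data.Rational using (ℚ; 0ℚ; 1ℚ; ½; _+_; _*_; _≤_; _<_)
open import Data.Rational.Properties using (_≤?_; _<?_)
open import Data.Product using (_×_)
open import Relation.Nullary using (¬_; ⌊_⌋)
open import Relation.Binary.PropositionalEquality using (_≡_; _≢_)

-- An edge (i , j) between server i ∈ Fin n and job j (jobs of a time step
-- are labelled by natural numbers), with weight w(i,j).
record Edge (n : ℕ) : Set where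
  constructor edge
  field
    server : Fin n
    job    : ℕ
    weight : ℚ
open Edge public

Step : ℕ → Set
Step n = List (Edge n)

-- An instance: the sequence G(1), …, G(T) (T = length of the list).
Instance : ℕ → Set
Instance n = List (Step n)

-- E(t) is a *set* of edges: no pair (i , j) occurs twice.
SimpleStep : ∀ {n} → Step n → Set
SimpleStep G = AllPairs (λ e f → ¬ (server e ≡ server f × job e ≡ job f)) G

WellFormedStep : ∀ {n} → (Fin n → ℚ) → Step n → Set
WellFormedStep C G =
  SimpleStep G × All (λ e → (0ℚ ≤ weight e) × (weight e ≤ C (server e))) G

W : ∀ {n} → List (Edge n) → ℚ
W = foldr (λ e s → weight e + s) 0ℚ

IsMatching : ∀ {n} → List (Edge n) → Set
IsMatching M = AllPairs (λ e f → (server e ≢ server f) × (job e ≢ job f)) M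

edgesAt : ∀ {n} → Fin n → List (Edge n) → List (Edge n)
edgesAt i = filter (λ e → server e Fin.≟ i)

-- F is given step by step: F(t) ⊆ E(t) (as a sub-list of E(t)).
Feasible : ∀ {n} → (Fin n → ℚ) → Instance n → List (Step n) → Set
Feasible {n} C inst F =
  Pointwise _⊆_ F inst
  × All IsMatching F
  × ((i : Fin n) → W (edgesAt i (concat F)) ≤ C i)

_≡ᶠ_ : ∀ {n} → Fin n → Fin n → Bool
i ≡ᶠ k = ⌊ i Fin.≟ k ⌋

insertDesc : ∀ {n} → Edge n → List (Edge n) → List (Edge n)
insertDesc e [] = e ∷ []
insertDesc e (f ∷ fs) =
  if ⌊ weight f <? weight e ⌋ then e ∷ f ∷ fs else f ∷ insertDesc e fs

-- sort by non-increasing weight (ties kept in input order; since the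
-- input order is arbitrary, every tie-breaking rule is covered)
sortDesc : ∀ {n} → List (Edge n) → List (Edge n)
sortDesc = foldr insertDesc []

greedyScan : ∀ {n} → (Fin n → Bool) → List (Edge n) → List (Edge n) → List (Edge n)
greedyScan S M [] = M
greedyScan S M (e ∷ es) =
  if S (server e)
     ∧ not (any (λ f → server f ≡ᶠ server e) M)
     ∧ not (any (λ f → job f ≡ᵇ job e) M)
  then greedyScan S (M ++ (e ∷ [])) es
  else greedyScan S M es

GREEDY : ∀ {n} → Step n → (Fin n → Bool) → List (Edge n)
GREEDY G S = greedyScan S [] (sortDesc G)

record State (n : ℕ) : Set where
  constructor state
  field
    S  : Fin n → Bool
    WB : Fin n → ℚ            -- W(B_i)
    A  : List (Edge n)        -- ⋃_i A_i
open State public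

initState : ∀ {n} → State n
initState = state (λ _ → true) (λ _ → 0ℚ) []

processEdge : ∀ {n} → (Fin n → ℚ) → (Fin n → Bool) → State n → Edge n → State n
processEdge C v (state S WB A) e =
  let i   = server e
      w   = weight e
      WBi = WB i + w
      WB' = λ k → if k ≡ᶠ i then WBi else WB k
      S'  = λ k → if k ≡ᶠ i then (if ⌊ ½ * C i <? WBi ⌋ then false else S k) else S k
      addA = (v i ∧ ⌊ ½ * C i <? w ⌋) ∨ (not (v i) ∧ ⌊ w ≤? ½ * C i ⌋)
      A'  = if addA then A ++ (e ∷ []) else A
  in state S' WB' A'

step : ∀ {n} → (Fin n → ℚ) → (Fin n → Bool) → State n → Step n → State n
step C v st G = foldlE (GREEDY G (S st)) st
  where
  foldlE : List _ → State _ → State _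
  foldlE [] s = s
  foldlE (e ∷ es) s = foldlE es (processEdge C v s e)

runFrom : ∀ {n} → (Fin n → ℚ) → (Fin n → Bool) → State n → Instance n → State n
runFrom C v st [] = st
runFrom C v st (G ∷ Gs) = runFrom C v (step C v st G) Gs

RandomOnlineGreedy : ∀ {n} → (Fin n → ℚ) → (Fin n → Bool) → Instance n → List (Edge n)
RandomOnlineGreedy C v inst = A (runFrom C v initState inst)

consᶠ : ∀ {n} → Bool → (Fin n → Bool) → Fin (suc n) → Bool
consᶠ b v zero    = b
consᶠ b v (suc k) = v k

allCoins : (n : ℕ) → List (Fin n → Bool)
allCoins zero    = (λ ()) ∷ []
allCoins (suc n) = concatMap (λ v → consᶠ false v ∷ consᶠ true v ∷ []) (allCoins n)

sumℚ : List ℚ → ℚ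
sumℚ = foldr _+_ 0ℚ

half^ : ℕ → ℚ
half^ zero    = 1ℚ
half^ (suc k) = ½ * half^ k

ExpectedWeight : ∀ {n} → (Fin n → ℚ) → Instance n → ℚ
ExpectedWeight {n} C inst =
  half^ n * sumℚ (map (λ v → W (RandomOnlineGreedy C v inst)) (allCoins n))

{-# OPTIONS --safe #-}
module Submission where

-- Let B be the list of edges chosen by GREEDY during the run and U the set of servers that are
-- never removed from S. Neither depends on the coins, and an edge of B enters A for exactly one
-- value of its server's coin (heavy edges for v = 1, light ones for v = 0), so E[W(A)] = ½ W(B).
-- Let F be feasible. An edge e ∈ F(t) at a server of U was available to GREEDY at step t, so GREEDY
-- chose an edge m with w(m) ≥ w(e) sharing the server or the job of e. Charging e to m, each m is
-- charged at most w(m) through its server (and only if that server is in U) and at most w(m)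
-- through its job, because F(t) is a matching. A server i ∉ U ends with W(B_i) > C_i / 2, so F puts
-- at most C_i < 2 W(B_i) on it. Hence W(F) ≤ (W(B_U) + W(B)) + 2 W(B_{∉U}) ≤ 3 W(B) = 6 E[W(A)].

open import Defs
open import Data.Bool using (Bool; true; false; if_then_else_; not; _∧_; _∨_; T)
open import Data.Bool.ListAction using (any)
open import Data.Bool.Properties using (T-≡; T-∧; T-∨; T-not-≡)
open import Data.Fin as Fin using (Fin; zero; suc)
open import Data.List using (List; []; _∷_; _++_; concat; concatMap; foldr; foldl; tabulate; allFin)
open import Data.List.Membership.Propositional using (_∈_; lose; find)
open import Data.List.Properties using (foldl-++; foldr-map)
open import Data.List.Relation.Binary.Permutation.Propositional using (_↭_; ↭-refl; ↭-sym; ↭-trans; prep; swap)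
open import Data.List.Relation.Binary.Permutation.Propositional.Properties using (All-resp-↭; ∈-resp-↭)
open import Data.List.Relation.Binary.Pointwise using (Pointwise; []; _∷_)
open import Data.List.Relation.Binary.Sublist.Propositional as Sublist using (_⊆_)
open import Data.List.Relation.Unary.All as All using (All; []; _∷_)
open import Data.List.Relation.Unary.All.Properties using (++⁺)
open import Data.List.Relation.Unary.AllPairs as AllPairs using (AllPairs; []; _∷_)
open import Data.List.Relation.Unary.Any as Any using (Any; here; there)
open import Data.List.Relation.Unary.Any.Properties using (any⁻; ++⁺ˡ; ++⁺ʳ)
open import Data.Nat using (ℕ; zero; suc; _≡ᵇ_)
import Data.Nat.Properties as ℕ
open import Data.Product using (_×_; _,_; proj₁; proj₂)
open import Data.Rational using (ℚ; 0ℚ; ½; _/_; _+_; _*_; _≤_; _<_)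
import Data.Rational.Properties as ℚ
open import Data.Rational.Solver using (module +-*-Solver)
open import Data.Sum as Sum using (_⊎_; inj₁; inj₂)
open import Function using (_∘_; id; Equivalence)
open import Relation.Binary.Definitions using (DecidableEquality)
open import Relation.Binary.PropositionalEquality
  using (_≡_; _≢_; refl; sym; trans; cong; cong₂; subst; module ≡-Reasoning)
open import Relation.Nullary using (yes; no; ⌊_⌋; contradiction)
open import Relation.Nullary.Decidable using (toWitness; fromWitness)

open +-*-Solver

-- Sums over lists

module _ {a} {X : Set a} where

  ∑ : List X → (X → ℚ) → ℚ
  ∑ xs f = foldr (λ x s → f x + s) 0ℚ xs

  infix 8 ∑
  syntax ∑ xs (λ x → t) = ∑[ x ← xs ] t

  ∑-++ : ∀ xs ys (f : X → ℚ) → ∑ (xs ++ ys) f ≡ ∑ xs f + ∑ ys f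
  ∑-++ []       ys f = sym (ℚ.+-identityˡ _)
  ∑-++ (x ∷ xs) ys f = trans (cong (f x +_) (∑-++ xs ys f)) (sym (ℚ.+-assoc (f x) _ _))

  ∑-cong : ∀ xs {f g : X → ℚ} → (∀ x → f x ≡ g x) → ∑ xs f ≡ ∑ xs g
  ∑-cong []       f≗g = refl
  ∑-cong (x ∷ xs) f≗g = cong₂ _+_ (f≗g x) (∑-cong xs f≗g)

  ∑-0 : ∀ xs → ∑[ x ← xs ] 0ℚ ≡ 0ℚ
  ∑-0 []       = refl
  ∑-0 (x ∷ xs) = trans (ℚ.+-identityˡ _) (∑-0 xs)

  ∑-zero : ∀ {xs} {f : X → ℚ} → All (λ x → f x ≡ 0ℚ) xs → ∑ xs f ≡ 0ℚ
  ∑-zero []           = refl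
  ∑-zero (fx≡0 ∷ f≡0) = trans (cong₂ _+_ fx≡0 (∑-zero f≡0)) (ℚ.+-identityˡ 0ℚ)

  ∑-+ : ∀ xs (f g : X → ℚ) → ∑[ x ← xs ] (f x + g x) ≡ ∑ xs f + ∑ xs g
  ∑-+ []       f g = refl
  ∑-+ (x ∷ xs) f g = trans (cong (f x + g x +_) (∑-+ xs f g))
    (solve 4 (λ a b c d → (a :+ b) :+ (c :+ d) := (a :+ c) :+ (b :+ d)) refl
      (f x) (g x) (∑ xs f) (∑ xs g))

  ∑-*ˡ : ∀ xs c (f : X → ℚ) → ∑[ x ← xs ] (c * f x) ≡ c * ∑ xs f
  ∑-*ˡ []       c f = sym (ℚ.*-zeroʳ c)
  ∑-*ˡ (x ∷ xs) c f = trans (cong (c * f x +_) (∑-*ˡ xs c f)) (sym (ℚ.*-distribˡ-+ c (f x) _))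

  ∑-mono-≤ : ∀ {xs} {f g : X → ℚ} → All (λ x → f x ≤ g x) xs → ∑ xs f ≤ ∑ xs g
  ∑-mono-≤ []            = ℚ.≤-refl
  ∑-mono-≤ (fx≤gx ∷ f≤g) = ℚ.+-mono-≤ fx≤gx (∑-mono-≤ f≤g)

  ∑-nonNeg : ∀ {xs} {f : X → ℚ} → All (λ x → 0ℚ ≤ f x) xs → 0ℚ ≤ ∑ xs f
  ∑-nonNeg {xs} {f} 0≤f = subst (_≤ ∑ xs f) (∑-0 xs) (∑-mono-≤ 0≤f)

  Any-≤-∑ : ∀ {xs} {f : X → ℚ} {y}
    → All (λ x → 0ℚ ≤ f x) xs → Any (λ x → y ≤ f x) xs → y ≤ ∑ xs f
  Any-≤-∑ (_    ∷ 0≤f) (here y≤fx) =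
    subst (_≤ _) (ℚ.+-identityʳ _) (ℚ.+-mono-≤ y≤fx (∑-nonNeg 0≤f))
  Any-≤-∑ (0≤fx ∷ 0≤f) (there y≤f) =
    subst (_≤ _) (ℚ.+-identityˡ _) (ℚ.+-mono-≤ 0≤fx (Any-≤-∑ 0≤f y≤f))

∑-comm : ∀ {a b} {X : Set a} {Y : Set b} xs ys (f : X → Y → ℚ)
  → ∑[ x ← xs ] ∑[ y ← ys ] f x y ≡ ∑[ y ← ys ] ∑[ x ← xs ] f x y
∑-comm []       ys f = sym (∑-0 ys)
∑-comm (x ∷ xs) ys f =
  trans (cong (∑ ys (f x) +_) (∑-comm xs ys f)) (sym (∑-+ ys (f x) (λ y → ∑[ x′ ← xs ] f x′ y)))

∑-concatMap : ∀ {a b} {X : Set a} {Y : Set b} (g : X → List Y) xs (f : Y → ℚ)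
  → ∑ (concatMap g xs) f ≡ ∑[ x ← xs ] ∑ (g x) f
∑-concatMap g []       f = refl
∑-concatMap g (x ∷ xs) f =
  trans (∑-++ (g x) (concatMap g xs) f) (cong (∑ (g x) f +_) (∑-concatMap g xs f))

∑-tabulate : ∀ {a} {X : Set a} {n} (g : Fin n → X) (f : X → ℚ)
  → ∑ (tabulate g) f ≡ ∑[ i ← allFin n ] f (g i)
∑-tabulate {n = zero}  g f = refl
∑-tabulate {n = suc n} g f =
  cong (f (g zero) +_) (trans (∑-tabulate (g ∘ suc) f) (sym (∑-tabulate suc (f ∘ g))))

≤-+-nonNeg : ∀ {x y} → 0ℚ ≤ y → x ≤ x + y
≤-+-nonNeg {x} {y} 0≤y = subst (_≤ x + y) (ℚ.+-identityʳ x) (ℚ.+-monoʳ-≤ x 0≤y)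

infixr 8 [_]·_

[_]·_ : Bool → ℚ → ℚ
[ b ]· x = if b then x else 0ℚ

[]·-+ : ∀ b x y → [ b ]· (x + y) ≡ [ b ]· x + [ b ]· y
[]·-+ true  x y = refl
[]·-+ false x y = sym (ℚ.+-identityˡ 0ℚ)

[]·-nonNeg : ∀ b {x} → 0ℚ ≤ x → 0ℚ ≤ [ b ]· x
[]·-nonNeg true  0≤x = 0≤x
[]·-nonNeg false _   = ℚ.≤-refl

[]·-comm : ∀ a b x → [ a ]· [ b ]· x ≡ [ b ]· [ a ]· x
[]·-comm true  b     x = refl
[]·-comm false true  x = refl
[]·-comm false false x = refl

[]·-split : ∀ b x → x ≡ [ b ]· x + [ not b ]· x
[]·-split true  x = sym (ℚ.+-identityʳ x)
[]·-split false x = sym (ℚ.+-identityˡ x)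

≤-[]·+[]· : ∀ a b {x} → T (a ∨ b) → 0ℚ ≤ x → x ≤ [ a ]· x + [ b ]· x
≤-[]·+[]· true  b     _ 0≤x = ≤-+-nonNeg ([]·-nonNeg b 0≤x)
≤-[]·+[]· false true  _ _   = ℚ.≤-reflexive (sym (ℚ.+-identityˡ _))

∑-[]· : ∀ {a} {X : Set a} xs b (f : X → ℚ) → ∑[ x ← xs ] [ b ]· f x ≡ [ b ]· ∑ xs f
∑-[]· xs true  f = refl
∑-[]· xs false f = ∑-0 xs

∑-split : ∀ {a} {X : Set a} xs (b : X → Bool) (f : X → ℚ)
  → ∑ xs f ≡ ∑[ x ← xs ] [ b x ]· f x + ∑[ x ← xs ] [ not (b x) ]· f x
∑-split xs b f =
  trans (∑-cong xs (λ x → []·-split (b x) (f x))) (∑-+ xs (λ x → [ b x ]· f x) (λ x → [ not (b x) ]· f x))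

∑-unique-key-≤ : ∀ {a k} {X : Set a} {K : Set k} (_≟_ : DecidableEquality K) (key : X → K) (κ : K) {c}
  → 0ℚ ≤ c → ∀ {xs} → AllPairs (λ x y → key x ≢ key y) xs
  → ∑[ x ← xs ] [ ⌊ κ ≟ key x ⌋ ]· c ≤ c
∑-unique-key-≤ _≟_ key κ 0≤c [] = 0≤c
∑-unique-key-≤ _≟_ key κ {c} 0≤c {x ∷ xs} (x≢xs ∷ distinct) with κ ≟ key x
... | yes refl = ℚ.≤-reflexive (trans (cong (c +_) (∑-zero (All.map absent x≢xs))) (ℚ.+-identityʳ c))
  where
  absent : ∀ {y} → key x ≢ key y → [ ⌊ key x ≟ key y ⌋ ]· c ≡ 0ℚ
  absent {y} kx≢ky with key x ≟ key y
  ... | yes kx≡ky = contradiction kx≡ky kx≢ky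
  ... | no _      = refl
... | no _ = subst (_≤ c) (sym (ℚ.+-identityˡ _)) (∑-unique-key-≤ _≟_ key κ 0≤c distinct)

≡ᶠ-suc : ∀ {n} (k i : Fin n) → (suc k ≡ᶠ suc i) ≡ (k ≡ᶠ i)
≡ᶠ-suc k i with k Fin.≟ i
... | yes _ = refl
... | no _  = refl

∑-allFin-δ : ∀ {n} (k : Fin n) (g : Fin n → ℚ) → ∑[ i ← allFin n ] [ k ≡ᶠ i ]· g i ≡ g k
∑-allFin-δ {suc n} zero g =
  trans (cong (g zero +_) (trans (∑-tabulate suc (λ i → [ zero ≡ᶠ i ]· g i)) (∑-0 (allFin n))))
        (ℚ.+-identityʳ (g zero))
∑-allFin-δ {suc n} (suc k) g =
  trans (ℚ.+-identityˡ _) (trans (∑-tabulate suc (λ i → [ suc k ≡ᶠ i ]· g i))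
    (trans (∑-cong (allFin n) (λ i → cong (λ b → [ b ]· g (suc i)) (≡ᶠ-suc k i)))
           (∑-allFin-δ k (g ∘ suc))))

∑-by-server : ∀ {n} (P : Fin n → Bool) (f : Edge n → ℚ) L
  → ∑[ i ← allFin n ] [ P i ]· ∑[ e ← L ] [ server e ≡ᶠ i ]· f e ≡ ∑[ e ← L ] [ P (server e) ]· f e
∑-by-server {n} P f L = begin
  ∑[ i ← allFin n ] [ P i ]· ∑[ e ← L ] [ server e ≡ᶠ i ]· f e
    ≡⟨ ∑-cong (allFin n) (λ i → sym (∑-[]· L (P i) _)) ⟩
  ∑[ i ← allFin n ] ∑[ e ← L ] [ P i ]· [ server e ≡ᶠ i ]· f e
    ≡⟨ ∑-comm (allFin n) L (λ i e → [ P i ]· [ server e ≡ᶠ i ]· f e) ⟩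
  ∑[ e ← L ] ∑[ i ← allFin n ] [ P i ]· [ server e ≡ᶠ i ]· f e
    ≡⟨ ∑-cong L (λ e → trans (∑-cong (allFin n) (λ i → []·-comm (P i) _ (f e)))
                             (∑-allFin-δ (server e) (λ i → [ P i ]· f e))) ⟩
  ∑[ e ← L ] [ P (server e) ]· f e ∎
  where open ≡-Reasoning

W-edgesAt : ∀ {n} (i : Fin n) L → W (edgesAt i L) ≡ ∑[ e ← L ] [ server e ≡ᶠ i ]· weight e
W-edgesAt i []       = refl
W-edgesAt i (e ∷ es) with server e Fin.≟ i
... | yes _ = cong (weight e +_) (W-edgesAt i es)
... | no _  = trans (W-edgesAt i es) (sym (ℚ.+-identityˡ _))

module _ {n : ℕ} where

  Sorted : List (Edge n) → Set
  Sorted = AllPairs (λ e f → weight f ≤ weight e)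

  insertDesc-↭ : ∀ e fs → insertDesc {n} e fs ↭ e ∷ fs
  insertDesc-↭ e []       = ↭-refl
  insertDesc-↭ e (f ∷ fs) with weight f ℚ.<? weight e
  ... | yes _ = ↭-refl
  ... | no _  = ↭-trans (prep f (insertDesc-↭ e fs)) (swap f e ↭-refl)

  sortDesc-↭ : ∀ G → sortDesc {n} G ↭ G
  sortDesc-↭ []       = ↭-refl
  sortDesc-↭ (e ∷ es) = ↭-trans (insertDesc-↭ e (sortDesc es)) (prep e (sortDesc-↭ es))

  insertDesc-sorted : ∀ e {fs} → Sorted fs → Sorted (insertDesc e fs)
  insertDesc-sorted e {[]}     []                 = [] ∷ []
  insertDesc-sorted e {f ∷ fs} (f≥fs ∷ fs-sorted) with weight f ℚ.<? weight e
  ... | yes f<e =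
    (ℚ.<⇒≤ f<e ∷ All.map (λ g≤f → ℚ.≤-trans g≤f (ℚ.<⇒≤ f<e)) f≥fs) ∷ f≥fs ∷ fs-sorted
  ... | no f≮e  =
    All-resp-↭ (↭-sym (insertDesc-↭ e fs)) (ℚ.≮⇒≥ f≮e ∷ f≥fs) ∷ insertDesc-sorted e fs-sorted

  sortDesc-sorted : ∀ G → Sorted (sortDesc {n} G)
  sortDesc-sorted []       = []
  sortDesc-sorted (e ∷ es) = insertDesc-sorted e (sortDesc-sorted es)

  DominatedBy : Edge n → Edge n → Set
  DominatedBy e m = weight e ≤ weight m × (server m ≡ server e ⊎ job m ≡ job e)

  module _ (S : Fin n → Bool) where

    admits : List (Edge n) → Edge n → Bool
    admits M x =
      S (server x) ∧ not (any (λ f → server f ≡ᶠ server x) M) ∧ not (any (λ f → job f ≡ᵇ job x) M)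

    greedyScan-All : ∀ {p} {P : Edge n → Set p} {M} L → All P M → All P L → All P (greedyScan S M L)
    greedyScan-All []                PM _           = PM
    greedyScan-All {M = M} (x ∷ xs) PM (Px ∷ Pxs) with admits M x
    ... | true  = greedyScan-All xs (++⁺ PM (Px ∷ [])) Pxs
    ... | false = greedyScan-All xs PM Pxs

    Any-greedyScan : ∀ {p} {P : Edge n → Set p} {M} L → Any P M → Any P (greedyScan S M L)
    Any-greedyScan []                PM = PM
    Any-greedyScan {M = M} (x ∷ xs) PM with admits M x
    ... | true  = Any-greedyScan xs (++⁺ˡ PM)
    ... | false = Any-greedyScan xs PM

    rejected-clashes : ∀ M x → T (S (server x)) → admits M x ≡ false
      → Any (λ f → server f ≡ server x ⊎ job f ≡ job x) M
    rejected-clashes M x Sx rejected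
      with S (server x)
         | any (λ f → server f ≡ᶠ server x) M in clash₁
         | any (λ f → job f ≡ᵇ job x) M in clash₂
    ... | true | true  | _    = Any.map (inj₁ ∘ toWitness) (any⁻ _ M (Equivalence.from T-≡ clash₁))
    ... | true | false | true = Any.map (inj₂ ∘ ℕ.≡ᵇ⇒≡ _ _) (any⁻ _ M (Equivalence.from T-≡ clash₂))

    greedyScan-dominates : ∀ M {L} → Sorted L → All (λ m → All (λ x → weight x ≤ weight m) L) M
      → ∀ {e} → e ∈ L → T (S (server e)) → Any (DominatedBy e) (greedyScan S M L)
    greedyScan-dominates M {x ∷ xs} _ M≥L (here refl) Sx with admits M x in admitted
    ... | true  = Any-greedyScan xs (++⁺ʳ M (here (ℚ.≤-refl , inj₁ refl)))
    ... | false =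
      let f , f∈M , clash = find (rejected-clashes M x Sx admitted)
      in Any-greedyScan xs (lose f∈M (All.head (All.lookup M≥L f∈M) , clash))
    greedyScan-dominates M {x ∷ xs} (x≥xs ∷ xs-sorted) M≥L (there e∈xs) Se with admits M x
    ... | true  = greedyScan-dominates (M ++ x ∷ []) xs-sorted (++⁺ (All.map All.tail M≥L) (x≥xs ∷ [])) e∈xs Se
    ... | false = greedyScan-dominates M xs-sorted (All.map All.tail M≥L) e∈xs Se

  GREEDY-All : ∀ {p} {P : Edge n → Set p} G S → All P G → All P (GREEDY G S)
  GREEDY-All G S PG = greedyScan-All S (sortDesc G) [] (All-resp-↭ (↭-sym (sortDesc-↭ G)) PG)

  GREEDY-dominates : ∀ G S {e} → e ∈ G → T (S (server e)) → Any (DominatedBy e) (GREEDY G S)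
  GREEDY-dominates G S e∈G =
    greedyScan-dominates S [] (sortDesc-sorted G) [] (∈-resp-↭ (↭-sym (sortDesc-↭ G)) e∈G)

-- Charging a matching to the edges chosen by GREEDY

module _ {n : ℕ} (u : Fin n → Bool) where

  server-hit job-hit : Edge n → Edge n → Bool
  server-hit e m = u (server m) ∧ (server m ≡ᶠ server e)
  job-hit    e m = ⌊ job m ℕ.≟ job e ⌋

  charge : Edge n → Edge n → ℚ
  charge e m = [ server-hit e m ]· weight m + [ job-hit e m ]· weight m

  charge-nonNeg : ∀ e {m} → 0ℚ ≤ weight m → 0ℚ ≤ charge e m
  charge-nonNeg e {m} 0≤w = ℚ.+-mono-≤ ([]·-nonNeg (server-hit e m) 0≤w) ([]·-nonNeg (job-hit e m) 0≤w)

  charge-covers : ∀ {e m} → T (u (server e)) → 0ℚ ≤ weight e → DominatedBy e m → weight e ≤ charge e m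
  charge-covers {e} {m} ue 0≤we (we≤wm , clash) =
    ℚ.≤-trans we≤wm (≤-[]·+[]· (server-hit e m) (job-hit e m) hit (ℚ.≤-trans 0≤we we≤wm))
    where
    via-server : server m ≡ server e → T (server-hit e m)
    via-server sm≡se = Equivalence.from T-∧ (subst (T ∘ u) (sym sm≡se) ue , fromWitness sm≡se)
    hit = Equivalence.from T-∨ (Sum.map via-server fromWitness clash)

  charge-received : ∀ m → 0ℚ ≤ weight m → ∀ {F} → IsMatching F
    → ∑[ e ← F ] charge e m ≤ [ u (server m) ]· weight m + weight m
  charge-received m 0≤w {F} matching = begin
    ∑[ e ← F ] charge e m                  ≡⟨ ∑-+ F (λ e → [ server-hit e m ]· weight m) (λ e → [ job-hit e m ]· weight m) ⟩
    through-server + through-job           ≤⟨ ℚ.+-mono-≤ through-server-≤ through-job-≤ ⟩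
    [ u (server m) ]· weight m + weight m  ∎
    where
    open ℚ.≤-Reasoning
    through-server = ∑[ e ← F ] [ server-hit e m ]· weight m
    through-job    = ∑[ e ← F ] [ job-hit e m ]· weight m
    through-job-≤ : through-job ≤ weight m
    through-job-≤ = ∑-unique-key-≤ ℕ._≟_ job (job m) 0≤w (AllPairs.map proj₂ matching)
    through-server-≤ : through-server ≤ [ u (server m) ]· weight m
    through-server-≤ with u (server m)
    ... | true  = ∑-unique-key-≤ Fin._≟_ server (server m) 0≤w (AllPairs.map proj₁ matching)
    ... | false = ℚ.≤-reflexive (∑-0 F)

  matching-≤-GREEDY : ∀ G (S : Fin n → Bool) {F} → (∀ i → T (u i) → T (S i))
    → All (λ e → 0ℚ ≤ weight e) G → F ⊆ G → IsMatching F
    → ∑[ e ← F ] [ u (server e) ]· weight e ≤ ∑[ m ← GREEDY G S ] ([ u (server m) ]· weight m + weight m)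
  matching-≤-GREEDY G S {F} u⊆S 0≤G F⊆G matching = begin
    ∑[ e ← F ] [ u (server e) ]· weight e  ≤⟨ ∑-mono-≤ (All.tabulate (covered ∘ Sublist.lookup F⊆G)) ⟩
    ∑[ e ← F ] ∑[ m ← M ] charge e m       ≡⟨ ∑-comm F M charge ⟩
    ∑[ m ← M ] ∑[ e ← F ] charge e m       ≤⟨ ∑-mono-≤ (All.map (λ {m} 0≤w → charge-received m 0≤w matching) 0≤M) ⟩
    ∑[ m ← M ] ([ u (server m) ]· weight m + weight m) ∎
    where
    open ℚ.≤-Reasoning
    M = GREEDY G S
    0≤M = GREEDY-All G S 0≤G
    covered : ∀ {e} → e ∈ G → [ u (server e) ]· weight e ≤ ∑[ m ← M ] charge e m
    covered {e} e∈G with u (server e) in ue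
    ... | false = ∑-nonNeg (All.map (charge-nonNeg e) 0≤M)
    ... | true  =
      Any-≤-∑ (All.map (charge-nonNeg e) 0≤M)
        (Any.map (charge-covers (Equivalence.from T-≡ ue) (All.lookup 0≤G e∈G))
                 (GREEDY-dominates G S e∈G (u⊆S (server e) (Equivalence.from T-≡ ue))))

-- Averaging over the coins

𝔼 : ∀ n → ((Fin n → Bool) → ℚ) → ℚ
𝔼 n f = half^ n * ∑[ v ← allCoins n ] f v

𝔼-cong : ∀ n {f g : (Fin n → Bool) → ℚ} → (∀ v → f v ≡ g v) → 𝔼 n f ≡ 𝔼 n g
𝔼-cong n f≗g = cong (half^ n *_) (∑-cong (allCoins n) f≗g)

𝔼-suc : ∀ n (f : (Fin (suc n) → Bool) → ℚ)
  → 𝔼 (suc n) f ≡ 𝔼 n (λ v → ½ * (f (consᶠ false v) + f (consᶠ true v)))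
𝔼-suc n f = begin
  (½ * half^ n) * ∑ (allCoins (suc n)) f
    ≡⟨ cong ((½ * half^ n) *_) (∑-concatMap (λ v → consᶠ false v ∷ consᶠ true v ∷ []) (allCoins n) f) ⟩
  (½ * half^ n) * ∑[ v ← allCoins n ] (f (consᶠ false v) + (f (consᶠ true v) + 0ℚ))
    ≡⟨ cong ((½ * half^ n) *_) (∑-cong (allCoins n) (λ v → cong (f (consᶠ false v) +_) (ℚ.+-identityʳ _))) ⟩
  (½ * half^ n) * ∑ (allCoins n) both
    ≡⟨ solve 2 (λ h x → (con ½ :* h) :* x := h :* (con ½ :* x)) refl (half^ n) (∑ (allCoins n) both) ⟩
  half^ n * (½ * ∑ (allCoins n) both)
    ≡⟨ cong (half^ n *_) (sym (∑-*ˡ (allCoins n) ½ both)) ⟩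
  𝔼 n (λ v → ½ * both v) ∎
  where
  open ≡-Reasoning
  both : (Fin n → Bool) → ℚ
  both v = f (consᶠ false v) + f (consᶠ true v)

½-double : ∀ x → ½ * (x + x) ≡ x
½-double = solve 1 (λ x → con ½ :* (x :+ x) := x) refl

𝔼-const : ∀ n c → 𝔼 n (λ _ → c) ≡ c
𝔼-const zero    c = trans (ℚ.*-identityˡ _) (ℚ.+-identityʳ c)
𝔼-const (suc n) c = trans (𝔼-suc n (λ _ → c)) (trans (𝔼-const n (½ * (c + c))) (½-double c))

𝔼-coin : ∀ n (i : Fin n) (g : Bool → ℚ) → 𝔼 n (λ v → g (v i)) ≡ ½ * (g false + g true)
𝔼-coin (suc n) zero    g = trans (𝔼-suc n (λ v → g (v zero))) (𝔼-const n _)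
𝔼-coin (suc n) (suc i) g =
  trans (𝔼-suc n (λ v → g (v (suc i)))) (trans (𝔼-cong n (λ v → ½-double (g (v i)))) (𝔼-coin n i g))

𝔼-∑ : ∀ {a} {X : Set a} n xs (f : (Fin n → Bool) → X → ℚ)
  → 𝔼 n (λ v → ∑[ x ← xs ] f v x) ≡ ∑[ x ← xs ] 𝔼 n (λ v → f v x)
𝔼-∑ n xs f = trans (cong (half^ n *_) (∑-comm (allCoins n) xs f)) (sym (∑-*ˡ xs (half^ n) _))

-- The coin-independent part of a State: S and i ↦ W(B_i). `spend` repeats the S- and WB-updates of
-- processEdge verbatim, so ledgerOf commutes with processEdge definitionally; this is what makes the
-- edges chosen by GREEDY independent of the coins.
record Ledger (n : ℕ) : Set where
  constructor ledger
  field
    active : Fin n → Bool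
    spent  : Fin n → ℚ
open Ledger

ledgerOf : ∀ {n} → State n → Ledger n
ledgerOf st = ledger (S st) (WB st)

module _ {n : ℕ} (C : Fin n → ℚ) where

  spend : Ledger n → Edge n → Ledger n
  spend (ledger act sp) e =
    let i   = server e
        spᵢ = sp i + weight e
    in ledger (λ k → if k ≡ᶠ i then (if ⌊ ½ * C i ℚ.<? spᵢ ⌋ then false else act k) else act k)
              (λ k → if k ≡ᶠ i then spᵢ else sp k)

  spendStep : Ledger n → Step n → Ledger n
  spendStep ℓ G = foldl spend ℓ (GREEDY G (active ℓ))

  chosen : Ledger n → Instance n → List (Edge n)
  chosen ℓ []       = []
  chosen ℓ (G ∷ Gs) = GREEDY G (active ℓ) ++ chosen (spendStep ℓ G) Gs

  final : Ledger n → Instance n → Ledger n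
  final ℓ inst = foldl spend ℓ (chosen ℓ inst)

  final-∷ : ∀ ℓ G Gs → final ℓ (G ∷ Gs) ≡ final (spendStep ℓ G) Gs
  final-∷ ℓ G Gs = foldl-++ spend ℓ (GREEDY G (active ℓ)) (chosen (spendStep ℓ G) Gs)

  spend-active : ∀ ℓ e i → T (active (spend ℓ e) i) → T (active ℓ i)
  spend-active ℓ e i with i ≡ᶠ server e
  ... | false = λ act → act
  ... | true with ⌊ ½ * C (server e) ℚ.<? spent ℓ (server e) + weight e ⌋
  ...   | true  = λ ()
  ...   | false = λ act → act

  foldl-spend-active : ∀ ℓ L i → T (active (foldl spend ℓ L) i) → T (active ℓ i)
  foldl-spend-active ℓ []       i act = act
  foldl-spend-active ℓ (e ∷ es) i act = spend-active ℓ e i (foldl-spend-active (spend ℓ e) es i act)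

  spend-spent : ∀ ℓ e k → spent (spend ℓ e) k ≡ spent ℓ k + [ server e ≡ᶠ k ]· weight e
  spend-spent ℓ e k with k Fin.≟ server e | server e Fin.≟ k
  ... | yes refl | yes _    = refl
  ... | yes refl | no i≢i   = contradiction refl i≢i
  ... | no k≢i   | yes refl = contradiction refl k≢i
  ... | no _     | no _     = sym (ℚ.+-identityʳ _)

  foldl-spend-spent : ∀ ℓ L k
    → spent (foldl spend ℓ L) k ≡ spent ℓ k + ∑[ e ← L ] [ server e ≡ᶠ k ]· weight e
  foldl-spend-spent ℓ []       k = sym (ℚ.+-identityʳ _)
  foldl-spend-spent ℓ (e ∷ es) k = begin
    spent (foldl spend (spend ℓ e) es) k                          ≡⟨ foldl-spend-spent (spend ℓ e) es k ⟩
    spent (spend ℓ e) k + load es                                 ≡⟨ cong (_+ load es) (spend-spent ℓ e k) ⟩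
    (spent ℓ k + [ server e ≡ᶠ k ]· weight e) + load es           ≡⟨ ℚ.+-assoc (spent ℓ k) _ (load es) ⟩
    spent ℓ k + load (e ∷ es)                                     ∎
    where
    open ≡-Reasoning
    load : List (Edge n) → ℚ
    load L = ∑[ e′ ← L ] [ server e′ ≡ᶠ k ]· weight e′

  Saturated : Ledger n → Set
  Saturated ℓ = ∀ i → T (not (active ℓ i)) → ½ * C i < spent ℓ i

  spend-saturated : ∀ ℓ e → 0ℚ ≤ weight e → Saturated ℓ → Saturated (spend ℓ e)
  spend-saturated ℓ e 0≤w sat i with i Fin.≟ server e
  ... | no _ = sat i
  ... | yes refl with ½ * C i ℚ.<? spent ℓ i + weight e
  ...   | yes over = λ _ → over
  ...   | no _     = λ inactive → ℚ.<-≤-trans (sat i inactive) (≤-+-nonNeg 0≤w)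

  foldl-spend-saturated : ∀ ℓ L → All (λ e → 0ℚ ≤ weight e) L
    → Saturated ℓ → Saturated (foldl spend ℓ L)
  foldl-spend-saturated ℓ []       []           sat = sat
  foldl-spend-saturated ℓ (e ∷ es) (0≤w ∷ 0≤ws) sat =
    foldl-spend-saturated (spend ℓ e) es 0≤ws (spend-saturated ℓ e 0≤w sat)

  chosen-nonNeg : ∀ ℓ {inst} → All (WellFormedStep C) inst → All (λ e → 0ℚ ≤ weight e) (chosen ℓ inst)
  chosen-nonNeg ℓ []                       = []
  chosen-nonNeg ℓ {G ∷ _} ((_ , wf) ∷ wfs) =
    ++⁺ (GREEDY-All G (active ℓ) (All.map proj₁ wf)) (chosen-nonNeg (spendStep ℓ G) wfs)

  keeps : Bool → Edge n → Bool
  keeps b e = (b ∧ ⌊ ½ * C (server e) ℚ.<? weight e ⌋) ∨ (not b ∧ ⌊ weight e ℚ.≤? ½ * C (server e) ⌋)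

  keeps-complementary : ∀ e → [ keeps false e ]· weight e + [ keeps true e ]· weight e ≡ weight e
  keeps-complementary e with ½ * C (server e) ℚ.<? weight e | weight e ℚ.≤? ½ * C (server e)
  ... | yes heavy | yes light = contradiction (ℚ.<-≤-trans heavy light) (ℚ.<-irrefl refl)
  ... | yes _     | no _      = ℚ.+-identityˡ (weight e)
  ... | no _      | yes _     = ℚ.+-identityʳ (weight e)
  ... | no heavy  | no light  = contradiction (ℚ.≮⇒≥ heavy) light

  module _ (v : Fin n → Bool) where

    foldl-unique : (f : List (Edge n) → State n → State n)
      → (∀ st → f [] st ≡ st) → (∀ e es st → f (e ∷ es) st ≡ f es (processEdge C v st e))
      → ∀ L st → f L st ≡ foldl (processEdge C v) st L
    foldl-unique f f-[] f-∷ []       st = f-[] st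
    foldl-unique f f-[] f-∷ (e ∷ es) st = trans (f-∷ e es st) (foldl-unique f f-[] f-∷ es _)

    -- `step` folds processEdge with a helper local to its where-block, which cannot be named here;
    -- the body of stepFold is a metavariable that unification below solves to that helper.
    mutual
      private
        stepFold : State n → Step n → List (Edge n) → State n → State n
        stepFold st G = _

      step-as-foldl : ∀ st G → step C v st G ≡ foldl (processEdge C v) st (GREEDY G (S st))
      step-as-foldl st G with GREEDY G (S st)
      ... | []     = refl
      ... | e ∷ es with processEdge C v st e
      ...   | st′  = foldl-unique (stepFold st G) (λ _ → refl) (λ _ _ _ → refl) es st′

    ledgerOf-foldl : ∀ st L → ledgerOf (foldl (processEdge C v) st L) ≡ foldl spend (ledgerOf st) L
    ledgerOf-foldl st []       = refl
    ledgerOf-foldl st (e ∷ es) = ledgerOf-foldl (processEdge C v st e) es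

    ledgerOf-step : ∀ st G → ledgerOf (step C v st G) ≡ spendStep (ledgerOf st) G
    ledgerOf-step st G = trans (cong ledgerOf (step-as-foldl st G)) (ledgerOf-foldl st (GREEDY G (S st)))

    kept : Edge n → ℚ
    kept e = [ keeps (v (server e)) e ]· weight e

    W-A-processEdge : ∀ st e → W (A (processEdge C v st e)) ≡ W (A st) + kept e
    W-A-processEdge st e with keeps (v (server e)) e
    ... | true  = trans (∑-++ (A st) (e ∷ []) weight) (cong (W (A st) +_) (ℚ.+-identityʳ (weight e)))
    ... | false = sym (ℚ.+-identityʳ (W (A st)))

    W-A-foldl : ∀ st L → W (A (foldl (processEdge C v) st L)) ≡ W (A st) + ∑ L kept
    W-A-foldl st []       = sym (ℚ.+-identityʳ (W (A st)))
    W-A-foldl st (e ∷ es) = begin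
      W (A (foldl (processEdge C v) (processEdge C v st e) es))  ≡⟨ W-A-foldl (processEdge C v st e) es ⟩
      W (A (processEdge C v st e)) + ∑ es kept                   ≡⟨ cong (_+ ∑ es kept) (W-A-processEdge st e) ⟩
      (W (A st) + kept e) + ∑ es kept                            ≡⟨ ℚ.+-assoc (W (A st)) (kept e) (∑ es kept) ⟩
      W (A st) + ∑ (e ∷ es) kept                                 ∎
      where open ≡-Reasoning

    W-A-runFrom : ∀ st inst → W (A (runFrom C v st inst)) ≡ W (A st) + ∑ (chosen (ledgerOf st) inst) kept
    W-A-runFrom st []       = sym (ℚ.+-identityʳ (W (A st)))
    W-A-runFrom st (G ∷ Gs) = begin
      W (A (runFrom C v (step C v st G) Gs))
        ≡⟨ W-A-runFrom (step C v st G) Gs ⟩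
      W (A (step C v st G)) + ∑ (chosen (ledgerOf (step C v st G)) Gs) kept
        ≡⟨ cong₂ (λ w ℓ → w + ∑ (chosen ℓ Gs) kept)
                 (trans (cong (W ∘ A) (step-as-foldl st G)) (W-A-foldl st M)) (ledgerOf-step st G) ⟩
      (W (A st) + ∑ M kept) + ∑ rest kept
        ≡⟨ ℚ.+-assoc (W (A st)) (∑ M kept) (∑ rest kept) ⟩
      W (A st) + (∑ M kept + ∑ rest kept)
        ≡⟨ cong (W (A st) +_) (sym (∑-++ M rest kept)) ⟩
      W (A st) + ∑ (M ++ rest) kept ∎
      where
      open ≡-Reasoning
      M    = GREEDY G (S st)
      rest = chosen (spendStep (ledgerOf st) G) Gs

  ledger₀ : Ledger n
  ledger₀ = ledgerOf initState

  expected-weight : ∀ inst → ExpectedWeight C inst ≡ ½ * W (chosen ledger₀ inst)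
  expected-weight inst = begin
    ExpectedWeight C inst
      ≡⟨ cong (half^ n *_) (foldr-map _+_ (λ v → W (RandomOnlineGreedy C v inst)) 0ℚ (allCoins n)) ⟩
    𝔼 n (λ v → W (RandomOnlineGreedy C v inst))
      ≡⟨ 𝔼-cong n (λ v → trans (W-A-runFrom v initState inst) (ℚ.+-identityˡ (∑ B (kept v)))) ⟩
    𝔼 n (λ v → ∑ B (kept v))
      ≡⟨ 𝔼-∑ n B kept ⟩
    ∑[ e ← B ] 𝔼 n (λ v → kept v e)
      ≡⟨ ∑-cong B (λ e → trans (𝔼-coin n (server e) (λ b → [ keeps b e ]· weight e))
                               (cong (½ *_) (keeps-complementary e))) ⟩
    ∑[ e ← B ] (½ * weight e)
      ≡⟨ ∑-*ˡ B ½ weight ⟩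
    ½ * W B ∎
    where
    open ≡-Reasoning
    B = chosen ledger₀ inst

  -- Comparison with a feasible solution

  unsaturated-≤-chosen : ∀ (u : Fin n → Bool) ℓ {inst F} → Pointwise _⊆_ F inst → All IsMatching F
    → All (WellFormedStep C) inst → (∀ i → T (u i) → T (active (final ℓ inst) i))
    → ∑[ e ← concat F ] [ u (server e) ]· weight e
      ≤ ∑[ m ← chosen ℓ inst ] ([ u (server m) ]· weight m + weight m)
  unsaturated-≤-chosen u ℓ [] [] [] _ = ℚ.≤-refl
  unsaturated-≤-chosen u ℓ {G ∷ Gs} {F ∷ Fs} (F⊆G ∷ Fs⊆Gs) (matching ∷ matchings) ((_ , wf) ∷ wfs) u⊆final =
    begin
      ∑ (F ++ concat Fs) opt       ≡⟨ ∑-++ F (concat Fs) opt ⟩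
      ∑ F opt + ∑ (concat Fs) opt  ≤⟨ ℚ.+-mono-≤ now later ⟩
      ∑ M alg + ∑ rest alg         ≡⟨ sym (∑-++ M rest alg) ⟩
      ∑ (M ++ rest) alg            ∎
    where
    open ℚ.≤-Reasoning
    opt alg : Edge n → ℚ
    opt e = [ u (server e) ]· weight e
    alg m = [ u (server m) ]· weight m + weight m
    M    = GREEDY G (active ℓ)
    rest = chosen (spendStep ℓ G) Gs
    u⊆now : ∀ i → T (u i) → T (active ℓ i)
    u⊆now i = foldl-spend-active ℓ (chosen ℓ (G ∷ Gs)) i ∘ u⊆final i
    u⊆later : ∀ i → T (u i) → T (active (final (spendStep ℓ G) Gs) i)
    u⊆later i = subst (λ ℓ′ → T (active ℓ′ i)) (final-∷ ℓ G Gs) ∘ u⊆final i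
    now = matching-≤-GREEDY u G (active ℓ) u⊆now (All.map proj₁ wf) F⊆G matching
    later = unsaturated-≤-chosen u (spendStep ℓ G) Fs⊆Gs matchings wfs u⊆later

  saturated-≤-2×chosen : ∀ (u : Fin n → Bool) F B → (∀ i → W (edgesAt i F) ≤ C i)
    → (∀ i → T (not (u i)) → ½ * C i < ∑[ e ← B ] [ server e ≡ᶠ i ]· weight e)
    → ∑[ e ← F ] [ not (u (server e)) ]· weight e
      ≤ ∑[ e ← B ] [ not (u (server e)) ]· weight e + ∑[ e ← B ] [ not (u (server e)) ]· weight e
  saturated-≤-2×chosen u F B capacity saturated = begin
    ∑[ e ← F ] [ not (u (server e)) ]· weight e
      ≡⟨ sym (∑-by-server (not ∘ u) weight F) ⟩
    ∑[ i ← allFin n ] [ not (u i) ]· load F i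
      ≤⟨ ∑-mono-≤ (All.tabulate {xs = allFin n} (λ {i} _ → per-server i)) ⟩
    ∑[ i ← allFin n ] [ not (u i) ]· (load B i + load B i)
      ≡⟨ ∑-cong (allFin n) (λ i → []·-+ (not (u i)) (load B i) (load B i)) ⟩
    ∑[ i ← allFin n ] ([ not (u i) ]· load B i + [ not (u i) ]· load B i)
      ≡⟨ ∑-+ (allFin n) (λ i → [ not (u i) ]· load B i) (λ i → [ not (u i) ]· load B i) ⟩
    ∑[ i ← allFin n ] [ not (u i) ]· load B i + ∑[ i ← allFin n ] [ not (u i) ]· load B i
      ≡⟨ cong₂ _+_ (∑-by-server (not ∘ u) weight B) (∑-by-server (not ∘ u) weight B) ⟩
    ∑[ e ← B ] [ not (u (server e)) ]· weight e + ∑[ e ← B ] [ not (u (server e)) ]· weight e ∎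
    where
    open ℚ.≤-Reasoning
    load : List (Edge n) → Fin n → ℚ
    load L i = ∑[ e ← L ] [ server e ≡ᶠ i ]· weight e
    per-server : ∀ i → [ not (u i) ]· load F i ≤ [ not (u i) ]· (load B i + load B i)
    per-server i with u i in ui
    ... | true  = ℚ.≤-refl
    ... | false = begin
      load F i             ≡⟨ sym (W-edgesAt i F) ⟩
      W (edgesAt i F)      ≤⟨ capacity i ⟩
      C i                  ≡⟨ solve 1 (λ c → c := con ½ :* c :+ con ½ :* c) refl (C i) ⟩
      ½ * C i + ½ * C i    ≤⟨ ℚ.+-mono-≤ (ℚ.<⇒≤ over) (ℚ.<⇒≤ over) ⟩
      load B i + load B i  ∎
      where over = saturated i (Equivalence.from T-not-≡ ui)

  optimum-≤-3×chosen : ∀ inst F → All (WellFormedStep C) inst → Feasible C inst F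
    → W (concat F) ≤ W (chosen ledger₀ inst) + W (chosen ledger₀ inst) + W (chosen ledger₀ inst)
  optimum-≤-3×chosen inst F wfs (F⊆inst , matchings , capacity) = begin
    W (concat F)                       ≡⟨ ∑-split (concat F) (u ∘ server) weight ⟩
    Fu + Fn                            ≤⟨ ℚ.+-mono-≤ (unsaturated-≤-chosen u ledger₀ F⊆inst matchings wfs (λ _ → id))
                                                     (saturated-≤-2×chosen u (concat F) B capacity saturated) ⟩
    ∑[ m ← B ] ([ u (server m) ]· weight m + weight m) + (Bn + Bn)
                                       ≡⟨ cong (_+ (Bn + Bn)) (∑-+ B (λ m → [ u (server m) ]· weight m) weight) ⟩
    (Bu + W B) + (Bn + Bn)             ≤⟨ ≤-+-nonNeg 0≤Bu ⟩
    (Bu + W B) + (Bn + Bn) + Bu        ≡⟨ cong (λ w → (Bu + w) + (Bn + Bn) + Bu) W≡Bu+Bn ⟩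
    (Bu + (Bu + Bn)) + (Bn + Bn) + Bu  ≡⟨ solve 2 (λ a b → (a :+ (a :+ b)) :+ (b :+ b) :+ a
                                                          := (a :+ b) :+ (a :+ b) :+ (a :+ b)) refl Bu Bn ⟩
    (Bu + Bn) + (Bu + Bn) + (Bu + Bn)  ≡⟨ cong (λ w → w + w + w) (sym W≡Bu+Bn) ⟩
    W B + W B + W B                    ∎
    where
    open ℚ.≤-Reasoning
    B = chosen ledger₀ inst
    u = active (final ledger₀ inst)
    Fu = ∑[ e ← concat F ] [ u (server e) ]· weight e
    Fn = ∑[ e ← concat F ] [ not (u (server e)) ]· weight e
    Bu = ∑[ e ← B ] [ u (server e) ]· weight e
    Bn = ∑[ e ← B ] [ not (u (server e)) ]· weight e
    W≡Bu+Bn : W B ≡ Bu + Bn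
    W≡Bu+Bn = ∑-split B (u ∘ server) weight
    0≤B = chosen-nonNeg ledger₀ wfs
    0≤Bu : 0ℚ ≤ Bu
    0≤Bu = ∑-nonNeg (All.map (λ {e} → []·-nonNeg (u (server e))) 0≤B)
    saturated : ∀ i → T (not (u i)) → ½ * C i < ∑[ e ← B ] [ server e ≡ᶠ i ]· weight e
    saturated i =
      subst (½ * C i <_) (trans (foldl-spend-spent ledger₀ B i) (ℚ.+-identityˡ _))
      ∘ foldl-spend-saturated ledger₀ B 0≤B (λ _ ()) i

open import Data.Integer using (+_)

theorem2 : (n : ℕ) (C : Fin n → ℚ) (inst : Instance n)
    → ((i : Fin n) → 0ℚ < C i)
    → All (WellFormedStep C) inst
    → (F : Instance n) → Feasible C inst F
    → (+ 1 / 6) * W (concat F) ≤ ExpectedWeight C inst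
theorem2 n C inst _ wfs F feasible = begin
  (+ 1 / 6) * W (concat F)       ≤⟨ ℚ.*-monoˡ-≤-nonNeg (+ 1 / 6) (optimum-≤-3×chosen C inst F wfs feasible) ⟩
  (+ 1 / 6) * (W B + W B + W B)  ≡⟨ solve 1 (λ x → con (+ 1 / 6) :* (x :+ x :+ x) := con ½ :* x) refl (W B) ⟩
  ½ * W B                        ≡⟨ sym (expected-weight C inst) ⟩
  ExpectedWeight C inst          ∎
  where
  open ℚ.≤-Reasoning
  B = chosen C (ledger₀ C) inst
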